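{- For any deterministic incremental algorithm that maintains an explicit 2-coloring of a bipartite graph on $n$ vertices (starting from the empty graph and processing edge insertions that keep the graph bipartite), the amortized update time is $\Omega(\log n)$ and the worst-case update time is $\Omega(n)$. Further, for such an algorithm, the amortized number of recolorings per update is $\Omega(\log n)$ and the worst-case number of recolorings per update is $\Omega(n)$.
   Context: An explicit coloring algorithm stores the color of every vertex after each update, so that these stored colors form a proper coloring (adjacent vertices receive different colors) of the current graph. A recoloring is a change of the color of one vertex during an update. The lower bounds are with respect to update sequences chosen adaptively against the (deterministic) algorithm. -}

module Defs where

open import Data.Nat using (ℕ; zero; suc; _+_; _*_; _≤_)
open import Data.Fin using (Fin)
open import Data.Fin.Properties using () renaming (_≟_ to _≟ᶠ_)
open import Data.Bool using (Bool)
open import Data.Bool.Properties using () renaming (_≟_ to _≟ᵇ_)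
open import Data.List using (List; []; _∷_; length; filter; allFin)
open import Data.List.Relation.Unary.All using (All)
open import Data.List.Membership.Propositional using (_∈_)
open import Data.Product using (_×_; _,_; ∃; proj₁; proj₂)
open import Data.Unit using (⊤)
open import Relation.Nullary using (¬_; ¬?)
open import Relation.Binary.PropositionalEquality using (_≡_; _≢_)

-- An edge on vertex set Fin n (unordered; stored as a pair).
Edge : ℕ → Set
Edge n = Fin n × Fin n

Coloring : ℕ → Set
Coloring n = Fin n → Bool

-- History of edge insertions, MOST RECENT FIRST: (e ∷ es) is the
-- history es followed by the insertion of e.  The current graph is
-- the set of edges in the list.
History : ℕ → Set
History n = List (Edge n)

Proper : ∀ {n} → History n → Coloring n → Set
Proper es χ = All (λ e → χ (proj₁ e) ≢ χ (proj₂ e)) es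

Bipartite : ∀ {n} → History n → Set
Bipartite {n} es = ∃ λ (χ : Coloring n) → Proper es χ

Valid : ∀ {n} → History n → Set
Valid [] = ⊤
Valid ((u , v) ∷ es) =
  Valid es × (u ≢ v) × ¬ ((u , v) ∈ es) × ¬ ((v , u) ∈ es)
  × Bipartite ((u , v) ∷ es)

-- A deterministic incremental algorithm on n vertices: its stored coloring
-- after each (adaptively chosen) sequence of insertions is determined by
-- that sequence.
Algorithm : ℕ → Set
Algorithm n = History n → Coloring n

Correct : ∀ {n} → Algorithm n → Set
Correct A = ∀ es → Valid es → Proper es (A es)

-- Number of vertices whose colour differs between two colorings
-- (= number of recolorings performed between them).
diff : ∀ {n} → Coloring n → Coloring n → ℕ
diff {n} χ χ' = length (filter (λ i → ¬? (χ i ≟ᵇ χ' i)) (allFin n))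

recol : ∀ {n} → Algorithm n → Edge n → History n → ℕ
recol A e es = diff (A (e ∷ es)) (A es)

totalRecol : ∀ {n} → Algorithm n → History n → ℕ
totalRecol A [] = 0
totalRecol A (e ∷ es) = recol A e es + totalRecol A es

-- The adversary builds a spanning tree on a block of 2^k vertices recursively: it
-- first forces a tree on each half, then joins them by an edge between two vertices
-- that currently have the same colour. A tree has only two proper 2-colourings, so
-- both halves are rigid and one of them, 2^(k-1) vertices, must be recoloured
-- entirely; a tree with an edge uses both colours, so such a pair exists once the
-- halves have at least two vertices. Summing over the recursion gives
-- (k - 1) 2^(k-1) recolourings for the 2^k - 1 insertions, and the last insertion
-- alone costs 2^(k-1). Taking 2^k ≤ n < 2^(k+1) gives both bounds.
module Submission where

open import Defs
open import Data.Nat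
  using (ℕ; zero; suc; _+_; _*_; _^_; _≤_; _<_; z≤n; s≤s; ⌊_/2⌋; ⌈_/2⌉; NonZero; >-nonZero; >-nonZero⁻¹; _<?_)
open import Data.Nat.Properties
open import Data.Nat.Logarithm using (⌊log₂_⌋; ⌊log₂⌋-mono-≤; ⌊log₂[2^n]⌋≡n; ⌊log₂⌊n/2⌋⌋≡⌊log₂n⌋∸1)
open import Data.Nat.Tactic.RingSolver using (solve-∀)
open import Data.Fin using (Fin; _↑ˡ_; _↑ʳ_; splitAt; join; inject≤)
open import Data.Fin.Properties using (injective⇒≤; ↑ˡ-injective; ↑ʳ-injective; splitAt-↑ˡ; splitAt-↑ʳ; join-splitAt; inject≤-injective; any?)
  renaming (_≟_ to _≟ᶠ_)
open import Data.Bool using (Bool; not)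
open import Data.Bool.Properties using (¬-not; not-¬; not-injective) renaming (_≟_ to _≟ᵇ_)
open import Data.List using ([]; _∷_; _++_; length; filter; allFin; lookup)
open import Data.List.Relation.Unary.All as All using (All; []; _∷_)
open import Data.List.Relation.Unary.All.Properties using (++⁺; ++⁻ʳ)
open import Data.List.Relation.Unary.Any using (index)
open import Data.List.Relation.Unary.Any.Properties using (lookup-index)
open import Data.List.Membership.Propositional using (_∈_)
open import Data.List.Membership.Propositional.Properties using (∈-filter⁺; ∈-allFin)
open import Data.List.Properties using (++-assoc; ++-identityʳ; length-++)
open import Data.Product using (_×_; _,_; proj₁; proj₂; ∃; ∃₂)
open import Data.Sum using (_⊎_; inj₁; inj₂)
open import Data.Unit using (⊤; tt)
open import Function using (_∘_)
open import Function.Definitions using (Injective)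
open import Relation.Nullary using (¬_; yes; no; ¬?; contradiction)
open import Relation.Nullary.Decidable using (map′)
open import Level using (0ℓ)
open import Relation.Unary using (Pred; Decidable; _⊆_)
open import Relation.Binary.PropositionalEquality

private
  variable
    m n s t : ℕ
    h : History n
    χ χ' : Coloring n

injective⇒≤diff : (g : Fin m → Fin n) → Injective _≡_ _≡_ g →
                  (∀ i → χ (g i) ≢ χ' (g i)) → m ≤ diff χ χ'
injective⇒≤diff {n = n} {χ = χ} {χ' = χ'} g g-inj recoloured = injective⇒≤ position-inj
  where
    open ≡-Reasoning
    differ? = λ i → ¬? (χ i ≟ᵇ χ' i)
    differing = filter differ? (allFin n)

    g∈ : ∀ i → g i ∈ differing
    g∈ i = ∈-filter⁺ differ? (∈-allFin (g i)) (recoloured i)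

    position-inj : Injective _≡_ _≡_ (index ∘ g∈)
    position-inj {i} {j} same = g-inj (begin
      g i                             ≡⟨ lookup-index (g∈ i) ⟩
      lookup differing (index (g∈ i)) ≡⟨ cong (lookup differing) same ⟩
      lookup differing (index (g∈ j)) ≡⟨ lookup-index (g∈ j) ⟨
      g j                             ∎)

agree-across : ∀ {x y x' y' : Bool} → x ≢ y → x' ≢ y' → x ≡ x' → y ≡ y'
agree-across x≢y x'≢y' x≡x' =
  trans (¬-not (x≢y ∘ sym)) (trans (cong not x≡x') (sym (¬-not (x'≢y' ∘ sym))))

↑ˡ≢↑ʳ : (i : Fin s) (j : Fin t) → i ↑ˡ t ≢ s ↑ʳ j
↑ˡ≢↑ʳ {s} {t} i j eq
  with () ← trans (sym (splitAt-↑ˡ s i t)) (trans (cong (splitAt s) eq) (splitAt-↑ʳ s t j))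

data Split (s t : ℕ) : Fin (s + t) → Set where
  is-↑ˡ : (i : Fin s) → Split s t (i ↑ˡ t)
  is-↑ʳ : (j : Fin t) → Split s t (s ↑ʳ j)

split : ∀ s t i → Split s t i
split s t i = subst (Split s t) (join-splitAt s t i) (from-sum (splitAt s i))
  where
    from-sum : (x : Fin s ⊎ Fin t) → Split s t (join s t x)
    from-sum (inj₁ i) = is-↑ˡ i
    from-sum (inj₂ j) = is-↑ʳ j

data Img (f : Fin m → Fin n) : Pred (Fin n) 0ℓ where
  img : ∀ i {x} → f i ≡ x → Img f x

img? : (f : Fin m → Fin n) → Decidable (Img f)
img? f x = map′ (λ (i , fi≡x) → img i fi≡x) (λ { (img i fi≡x) → i , fi≡x }) (any? (λ i → f i ≟ᶠ x))

data Within (S : Pred (Fin n) 0ℓ) : Pred (Edge n) 0ℓ where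
  within : ∀ {u v} → S u → S v → Within S (u , v)

data Outside (S : Pred (Fin n) 0ℓ) : Pred (Edge n) 0ℓ where
  outside : ∀ {u v} → ¬ S u → ¬ S v → Outside S (u , v)

Closed : History n → Pred (Fin n) 0ℓ → Set
Closed h S = All (λ e → Within S e ⊎ Outside S e) h

Within-⊆ : ∀ {S T : Pred (Fin n) 0ℓ} → S ⊆ T → Within S ⊆ Within T
Within-⊆ S⊆T (within su sv) = within (S⊆T su) (S⊆T sv)

Outside-⊇ : ∀ {S T : Pred (Fin n) 0ℓ} → S ⊆ T → Outside T ⊆ Outside S
Outside-⊇ S⊆T (outside tu tv) = outside (tu ∘ S⊆T) (tv ∘ S⊆T)

Within⇒Outside : ∀ {S T : Pred (Fin n) 0ℓ} → (∀ {x} → S x → ¬ T x) → Within S ⊆ Outside T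
Within⇒Outside disjoint (within su sv) = outside (disjoint su) (disjoint sv)

module _ {S : Pred (Fin n) 0ℓ} (S? : Decidable S) where

  flipOn : Coloring n → Coloring n
  flipOn χ x with S? x
  ... | yes _ = not (χ x)
  ... | no  _ = χ x

  flipOn-∈ : ∀ {x} → S x → flipOn χ x ≡ not (χ x)
  flipOn-∈ {x = x} sx with S? x
  ... | yes _ = refl
  ... | no ¬sx = contradiction sx ¬sx

  flipOn-∉ : ∀ {x} → ¬ S x → flipOn χ x ≡ χ x
  flipOn-∉ {x = x} ¬sx with S? x
  ... | yes sx = contradiction sx ¬sx
  ... | no  _ = refl

  flipOn-proper : Closed h S → Proper h χ → Proper h (flipOn χ)
  flipOn-proper [] [] = []
  flipOn-proper (inj₁ (within su sv) ∷ closed) (χu≢χv ∷ proper) =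
    (λ eq → χu≢χv (not-injective (trans (sym (flipOn-∈ su)) (trans eq (flipOn-∈ sv)))))
    ∷ flipOn-proper closed proper
  flipOn-proper (inj₂ (outside su sv) ∷ closed) (χu≢χv ∷ proper) =
    (λ eq → χu≢χv (trans (sym (flipOn-∉ su)) (trans eq (flipOn-∉ sv))))
    ∷ flipOn-proper closed proper

  -- A monochromatic new edge is repaired by flipping the side S containing v.
  valid-∷ : ∀ {u v} → Valid h → Proper h χ → Closed h S → ¬ S u → S v → u ≢ v →
            Valid ((u , v) ∷ h)
  valid-∷ {h = h} {χ = χ} {u} {v} valid proper closed u∉S v∈S u≢v =
    valid , u≢v , uv∉h , vu∉h , bipartite
    where
      uv∉h : ¬ (u , v) ∈ h
      uv∉h uv∈h with All.lookup closed uv∈h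
      ... | inj₁ (within u∈S _) = u∉S u∈S
      ... | inj₂ (outside _ v∉S) = v∉S v∈S

      vu∉h : ¬ (v , u) ∈ h
      vu∉h vu∈h with All.lookup closed vu∈h
      ... | inj₁ (within _ u∈S) = u∉S u∈S
      ... | inj₂ (outside v∉S _) = v∉S v∈S

      bipartite : Bipartite ((u , v) ∷ h)
      bipartite with χ u ≟ᵇ χ v
      ... | no χu≢χv = χ , χu≢χv ∷ proper
      ... | yes χu≡χv = flipOn χ , flipped ∷ flipOn-proper closed proper
        where
          flipped : flipOn χ u ≢ flipOn χ v
          flipped eq = not-¬ χu≡χv (trans (sym (flipOn-∉ u∉S)) (trans eq (flipOn-∈ v∈S)))

-- The block lies in one connected component of h.
Rigid : History n → (Fin m → Fin n) → Set
Rigid h f = ∀ {χ χ'} → Proper h χ → Proper h χ' →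
            ∀ i j → χ (f i) ≡ χ' (f i) → χ (f j) ≡ χ' (f j)

Bichromatic : History n → (Fin m → Fin n) → Set
Bichromatic h f = ∀ {χ} → Proper h χ → ∀ b → ∃ λ j → χ (f j) ≡ b

rigid-weaken : ∀ {h' : History n} {f : Fin m → Fin n} →
               (∀ {χ} → Proper h' χ → Proper h χ) → Rigid h f → Rigid h' f
rigid-weaken restrict rigid proper proper' = rigid (restrict proper) (restrict proper')

rigid-join : {f : Fin (s + t) → Fin n} (i₀ : Fin s) (j₀ : Fin t) →
             Rigid h (f ∘ (_↑ˡ t)) → Rigid h (f ∘ (s ↑ʳ_)) →
             Rigid ((f (i₀ ↑ˡ t) , f (s ↑ʳ j₀)) ∷ h) f
rigid-join {s = s} {t} {f = f} i₀ j₀ rigidˡ rigidʳ {χ} {χ'} (edge ∷ proper) (edge' ∷ proper') i j =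
  go (split s t i) (split s t j)
  where
    agreeˡ = rigidˡ proper proper'
    agreeʳ = rigidʳ proper proper'

    go : ∀ {i j} → Split s t i → Split s t j → χ (f i) ≡ χ' (f i) → χ (f j) ≡ χ' (f j)
    go (is-↑ˡ x) (is-↑ˡ y) = agreeˡ x y
    go (is-↑ˡ x) (is-↑ʳ y) = agreeʳ j₀ y ∘ agree-across edge edge' ∘ agreeˡ x i₀
    go (is-↑ʳ x) (is-↑ˡ y) = agreeˡ i₀ y ∘ agree-across (edge ∘ sym) (edge' ∘ sym) ∘ agreeʳ x j₀
    go (is-↑ʳ x) (is-↑ʳ y) = agreeʳ x y

bichromatic-∷ : {f : Fin m → Fin n} (i j : Fin m) → Bichromatic ((f i , f j) ∷ h) f
bichromatic-∷ {f = f} i j {χ} (edge ∷ _) b with χ (f i) ≟ᵇ b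
... | yes χfi≡b = i , χfi≡b
... | no  χfi≢b = j , trans (¬-not (edge ∘ sym)) (sym (¬-not (χfi≢b ∘ sym)))

recolours-a-block : ∀ {fˡ fʳ : Fin m → Fin n} →
  Injective _≡_ _≡_ fˡ → Injective _≡_ _≡_ fʳ → Rigid h fˡ → Rigid h fʳ →
  ∀ i₀ j₀ → Proper h χ → χ (fˡ i₀) ≡ χ (fʳ j₀) → Proper ((fˡ i₀ , fʳ j₀) ∷ h) χ' →
  m ≤ diff χ' χ
recolours-a-block {χ = χ} {χ'} {fˡ} {fʳ} fˡ-inj fʳ-inj rigidˡ rigidʳ i₀ j₀ proper same (edge' ∷ proper')
  with χ' (fˡ i₀) ≟ᵇ χ (fˡ i₀)
... | yes kept = injective⇒≤diff fʳ fʳ-inj (λ j → moved ∘ rigidʳ proper' proper j j₀)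
  where
    moved : χ' (fʳ j₀) ≢ χ (fʳ j₀)
    moved eq = edge' (trans kept (trans same (sym eq)))
... | no moved = injective⇒≤diff fˡ fˡ-inj (λ i → moved ∘ rigidˡ proper' proper i i₀)

pow2 : ℕ → ℕ
pow2 zero = 1
pow2 (suc k) = pow2 k + pow2 k

pow2≡2^ : ∀ k → pow2 k ≡ 2 ^ k
pow2≡2^ zero = refl
pow2≡2^ (suc k) = trans (cong₂ _+_ (pow2≡2^ k) (pow2≡2^ k)) (cong (2 ^ k +_) (sym (+-identityʳ (2 ^ k))))

pow2>0 : ∀ k → 0 < pow2 k
pow2>0 zero = s≤s z≤n
pow2>0 (suc k) = ≤-trans (pow2>0 k) (m≤m+n (pow2 k) (pow2 k))

origin : ∀ k → Fin (pow2 k)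
origin zero = Fin.zero
origin (suc k) = origin k ↑ˡ pow2 k

-- Two single vertices cannot be forced to share a colour, so the first merge is free.
mergeCost : ℕ → ℕ
mergeCost zero = 0
mergeCost (suc k) = pow2 (suc k)

forcingCost : ℕ → ℕ
forcingCost zero = 0
forcingCost (suc k) = forcingCost k + forcingCost k + mergeCost k

forcingCost-suc : ∀ k → forcingCost (suc k) ≡ k * pow2 k
forcingCost-suc zero = refl
forcingCost-suc (suc k) = begin
  forcingCost (suc k) + forcingCost (suc k) + (p + p) ≡⟨ cong (λ c → c + c + (p + p)) (forcingCost-suc k) ⟩
  k * p + k * p + (p + p)                             ≡⟨ rearrange k p ⟩
  suc k * (p + p)                                     ∎
  where
    open ≡-Reasoning
    p = pow2 k
    rearrange : ∀ k p → k * p + k * p + (p + p) ≡ suc k * (p + p)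
    rearrange = solve-∀

k*pow2≤4*forcingCost : ∀ k → 2 ≤ k → k * pow2 k ≤ 4 * forcingCost k
k*pow2≤4*forcingCost (suc zero) (s≤s ())
k*pow2≤4*forcingCost (suc (suc k)) _ = begin
  (2 + k) * (p + p)                 ≡⟨ rearrange k p ⟩
  4 * p + 2 * (k * p)               ≤⟨ m≤m+n (4 * p + 2 * (k * p)) (2 * (k * p)) ⟩
  4 * p + 2 * (k * p) + 2 * (k * p) ≡⟨ rearrange' k p ⟩
  4 * ((1 + k) * p)                 ≡⟨ cong (4 *_) (forcingCost-suc (suc k)) ⟨
  4 * forcingCost (2 + k)           ∎
  where
    open ≤-Reasoning
    p = pow2 (suc k)
    rearrange : ∀ k p → (2 + k) * (p + p) ≡ 4 * p + 2 * (k * p)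
    rearrange = solve-∀
    rearrange' : ∀ k p → 4 * p + 2 * (k * p) + 2 * (k * p) ≡ 4 * ((1 + k) * p)
    rearrange' = solve-∀

k≤⌊log₂n⌋⇒2^k≤n : ∀ k n .{{_ : NonZero n}} → k ≤ ⌊log₂ n ⌋ → 2 ^ k ≤ n
k≤⌊log₂n⌋⇒2^k≤n zero n _ = >-nonZero⁻¹ n
k≤⌊log₂n⌋⇒2^k≤n (suc k) (suc zero) ()
k≤⌊log₂n⌋⇒2^k≤n (suc k) (suc (suc m)) 1+k≤log = begin
  2 ^ suc k                  ≤⟨ *-monoʳ-≤ 2 (k≤⌊log₂n⌋⇒2^k≤n k (suc ⌊ m /2⌋) k≤log-half) ⟩
  2 * suc ⌊ m /2⌋            ≡⟨ cong (suc ⌊ m /2⌋ +_) (+-identityʳ (suc ⌊ m /2⌋)) ⟩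
  ⌊ 2 + m /2⌋ + ⌊ 2 + m /2⌋  ≤⟨ +-monoʳ-≤ ⌊ 2 + m /2⌋ (⌊n/2⌋≤⌈n/2⌉ (2 + m)) ⟩
  ⌊ 2 + m /2⌋ + ⌈ 2 + m /2⌉  ≡⟨ ⌊n/2⌋+⌈n/2⌉≡n (2 + m) ⟩
  2 + m                      ∎
  where
    open ≤-Reasoning
    k≤log-half : k ≤ ⌊log₂ suc ⌊ m /2⌋ ⌋
    k≤log-half = subst (k ≤_) (sym (⌊log₂⌊n/2⌋⌋≡⌊log₂n⌋∸1 (2 + m))) (∸-monoˡ-≤ 1 1+k≤log)

n<2^suc⌊log₂n⌋ : ∀ n → n < 2 ^ suc ⌊log₂ n ⌋
n<2^suc⌊log₂n⌋ n with n <? 2 ^ suc ⌊log₂ n ⌋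
... | yes n<2^ = n<2^
... | no n≮2^ = contradiction log-too-big (<-irrefl refl)
  where
    log-too-big : suc ⌊log₂ n ⌋ ≤ ⌊log₂ n ⌋
    log-too-big = subst (_≤ ⌊log₂ n ⌋) (⌊log₂[2^n]⌋≡n (suc ⌊log₂ n ⌋)) (⌊log₂⌋-mono-≤ (≮⇒≥ n≮2^))

module Adversary (A : Algorithm n) (correct : Correct A) where

  BichromaticIf : ℕ → History n → (Fin m → Fin n) → Set
  BichromaticIf zero    _ _ = ⊤
  BichromaticIf (suc _) h f = Bichromatic h f

  LastUpdateCosts : ℕ → History n → Set
  LastUpdateCosts zero    _ = ⊤
  LastUpdateCosts (suc k) h = ∃₂ λ e h' → h ≡ e ∷ h' × mergeCost k ≤ recol A e h'

  record Forced (k : ℕ) (f : Fin (pow2 k) → Fin n) (h : History n) : Set where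
    field
      edges         : History n
      history       : History n
      history≡      : history ≡ edges ++ h
      valid         : Valid history
      edges-within  : All (Within (Img f)) edges
      rigid         : Rigid history f
      bichromatic   : BichromaticIf k history f
      #edges        : suc (length edges) ≡ pow2 k
      cost          : forcingCost k + totalRecol A h ≤ totalRecol A history
      lastCost      : LastUpdateCosts k history

    restrict : Proper history χ → Proper h χ
    restrict {χ = χ} = ++⁻ʳ edges ∘ subst (λ hs → Proper hs χ) history≡

  Strategy : ℕ → Set
  Strategy k = (f : Fin (pow2 k) → Fin n) → Injective _≡_ _≡_ f →
               (h : History n) → Valid h → All (Outside (Img f)) h → Forced k f h

  forced-vertex : Strategy zero
  forced-vertex f _ h valid _ = record
    { edges = [] ; history = h ; history≡ = refl ; valid = valid ; edges-within = []
    ; rigid = λ { _ _ Fin.zero Fin.zero agree → agree }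
    ; bichromatic = tt ; #edges = refl ; cost = ≤-refl ; lastCost = tt }

  module Round (k : ℕ) (play : Strategy k) (f : Fin (pow2 (suc k)) → Fin n)
               (f-inj : Injective _≡_ _≡_ f) (h : History n) (h-valid : Valid h)
               (h-avoids : All (Outside (Img f)) h) where

    fˡ fʳ : Fin (pow2 k) → Fin n
    fˡ = f ∘ (_↑ˡ pow2 k)
    fʳ = f ∘ (pow2 k ↑ʳ_)

    fˡ-inj : Injective _≡_ _≡_ fˡ
    fˡ-inj = ↑ˡ-injective (pow2 k) _ _ ∘ f-inj
    fʳ-inj : Injective _≡_ _≡_ fʳ
    fʳ-inj = ↑ʳ-injective (pow2 k) _ _ ∘ f-inj

    Imgˡ⊆ : Img fˡ ⊆ Img f
    Imgˡ⊆ (img i fˡi≡x) = img (i ↑ˡ pow2 k) fˡi≡x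
    Imgʳ⊆ : Img fʳ ⊆ Img f
    Imgʳ⊆ (img j fʳj≡x) = img (pow2 k ↑ʳ j) fʳj≡x

    halves-disjoint : ∀ {x} → Img fˡ x → ¬ Img fʳ x
    halves-disjoint (img i fˡi≡x) (img j fʳj≡x) = ↑ˡ≢↑ʳ i j (f-inj (trans fˡi≡x (sym fʳj≡x)))

    left : Forced k fˡ h
    left = play fˡ fˡ-inj h h-valid (All.map (Outside-⊇ Imgˡ⊆) h-avoids)
    module Left = Forced left

    right : Forced k fʳ Left.history
    right = play fʳ fʳ-inj Left.history Left.valid
      (subst (All (Outside (Img fʳ))) (sym Left.history≡)
        (++⁺ (All.map (Within⇒Outside halves-disjoint) Left.edges-within)
             (All.map (Outside-⊇ Imgʳ⊆) h-avoids)))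
    module Right = Forced right

    h₂ : History n
    h₂ = Right.history

    h₂≡ : h₂ ≡ Right.edges ++ Left.edges ++ h
    h₂≡ = trans Right.history≡ (cong (Right.edges ++_) Left.history≡)

    χ₀ : Coloring n
    χ₀ = A h₂

    χ₀-proper : Proper h₂ χ₀
    χ₀-proper = correct h₂ Right.valid

    a : Fin n
    a = fˡ (origin k)

    h₂-closed : Closed h₂ (Img fʳ)
    h₂-closed = subst (λ hs → Closed hs (Img fʳ)) (sym h₂≡)
      (++⁺ (All.map inj₁ Right.edges-within)
      (++⁺ (All.map (inj₂ ∘ Within⇒Outside halves-disjoint) Left.edges-within)
           (All.map (inj₂ ∘ Outside-⊇ Imgʳ⊆) h-avoids)))

    module Merge (j₀ : Fin (pow2 k)) where

      e : Edge n
      e = a , fʳ j₀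

      e-valid : Valid (e ∷ h₂)
      e-valid = valid-∷ (img? fʳ) Right.valid χ₀-proper h₂-closed
        (halves-disjoint (img (origin k) refl)) (img j₀ refl)
        (λ a≡v → halves-disjoint (img (origin k) a≡v) (img j₀ refl))

      monochromatic⇒recolours-half : χ₀ a ≡ χ₀ (fʳ j₀) → pow2 k ≤ recol A e h₂
      monochromatic⇒recolours-half same = recolours-a-block fˡ-inj fʳ-inj
        (rigid-weaken Right.restrict Left.rigid) Right.rigid (origin k) j₀
        χ₀-proper same (correct (e ∷ h₂) e-valid)

      #edges : suc (length (e ∷ Right.edges ++ Left.edges)) ≡ pow2 (suc k)
      #edges = begin
        suc (suc (length (Right.edges ++ Left.edges)))       ≡⟨ cong (suc ∘ suc) (length-++ Right.edges) ⟩
        suc (suc (length Right.edges + length Left.edges))   ≡⟨ cong suc (+-suc (length Right.edges) (length Left.edges)) ⟨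
        suc (length Right.edges) + suc (length Left.edges)   ≡⟨ cong₂ _+_ Right.#edges Left.#edges ⟩
        pow2 k + pow2 k                                      ∎
        where open ≡-Reasoning

      cost : mergeCost k ≤ recol A e h₂ →
             forcingCost (suc k) + totalRecol A h ≤ totalRecol A (e ∷ h₂)
      cost merge-cost = begin
        T + T + mergeCost k + totalRecol A h   ≡⟨ rearrange T (mergeCost k) (totalRecol A h) ⟩
        mergeCost k + (T + (T + totalRecol A h))
          ≤⟨ +-mono-≤ merge-cost (≤-trans (+-monoʳ-≤ T Left.cost) Right.cost) ⟩
        recol A e h₂ + totalRecol A h₂         ∎
        where
          open ≤-Reasoning
          T = forcingCost k
          rearrange : ∀ x m t → x + x + m + t ≡ m + (x + (x + t))
          rearrange = solve-∀

      merged : mergeCost k ≤ recol A e h₂ → Forced (suc k) f h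
      merged merge-cost = record
        { edges = e ∷ Right.edges ++ Left.edges
        ; history = e ∷ h₂
        ; history≡ = cong (e ∷_) (trans h₂≡ (sym (++-assoc Right.edges Left.edges h)))
        ; valid = e-valid
        ; edges-within = within (Imgˡ⊆ (img (origin k) refl)) (Imgʳ⊆ (img j₀ refl))
                       ∷ ++⁺ (All.map (Within-⊆ Imgʳ⊆) Right.edges-within)
                             (All.map (Within-⊆ Imgˡ⊆) Left.edges-within)
        ; rigid = rigid-join (origin k) j₀ (rigid-weaken Right.restrict Left.rigid) Right.rigid
        ; bichromatic = bichromatic-∷ (origin k ↑ˡ pow2 k) (pow2 k ↑ʳ j₀)
        ; #edges = #edges
        ; cost = cost merge-cost
        ; lastCost = e , h₂ , refl , merge-cost
        }

  grow : ∀ k → Strategy k → Strategy (suc k)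
  grow zero play f f-inj h valid avoids = Merge.merged Fin.zero z≤n
    where open Round zero play f f-inj h valid avoids
  grow (suc k) play f f-inj h valid avoids =
    Merge.merged j₀ (Merge.monochromatic⇒recolours-half j₀ (sym χ₀fʳj₀≡χ₀a))
    where
      open Round (suc k) play f f-inj h valid avoids
      partner : ∃ λ j → χ₀ (fʳ j) ≡ χ₀ a
      partner = Right.bichromatic χ₀-proper (χ₀ a)
      j₀ = proj₁ partner
      χ₀fʳj₀≡χ₀a = proj₂ partner

  force : ∀ k → Strategy k
  force zero = forced-vertex
  force (suc k) = grow k (force k)

  amortized : ∀ k {f} (run : Forced k f []) → 2 ≤ k →
              let open Forced run in
              1 ≤ length history × length history * k ≤ 4 * totalRecol A history
  amortized (suc k) run 2≤k = 1≤#history , #history*k≤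
    where
      open Forced run
      open ≤-Reasoning

      #history≡#edges : length history ≡ length edges
      #history≡#edges = trans (cong length history≡) (cong length (++-identityʳ edges))

      1≤#history : 1 ≤ length history
      1≤#history = +-cancelˡ-≤ 1 1 (length history) (begin
        2                         ≤⟨ +-mono-≤ (pow2>0 k) (pow2>0 k) ⟩
        pow2 (suc k)              ≡⟨ #edges ⟨
        suc (length edges)        ≡⟨ cong suc #history≡#edges ⟨
        suc (length history)      ∎)

      #history*k≤ : length history * suc k ≤ 4 * totalRecol A history
      #history*k≤ = begin
        length history * suc k     ≡⟨ cong (_* suc k) #history≡#edges ⟩
        length edges * suc k       ≤⟨ *-monoˡ-≤ (suc k) (n≤1+n (length edges)) ⟩
        suc (length edges) * suc k ≡⟨ cong (_* suc k) #edges ⟩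
        pow2 (suc k) * suc k       ≡⟨ *-comm (pow2 (suc k)) (suc k) ⟩
        suc k * pow2 (suc k)       ≤⟨ k*pow2≤4*forcingCost (suc k) 2≤k ⟩
        4 * forcingCost (suc k)    ≤⟨ *-monoʳ-≤ 4 (≤-trans (m≤m+n (forcingCost (suc k)) 0) cost) ⟩
        4 * totalRecol A history   ∎

  worst-case : ∀ k {f} → Forced k f h → 2 ≤ k →
               ∃₂ λ e es → Valid (e ∷ es) × 2 * pow2 k ≤ 4 * recol A e es
  worst-case (suc zero) _ (s≤s ())
  worst-case (suc (suc k)) run _ with Forced.lastCost run
  ... | e , es , history≡e∷es , last-cost =
    e , es , subst Valid history≡e∷es (Forced.valid run) , (begin
      2 * (p + p)         ≡⟨ rearrange p ⟩
      4 * p               ≤⟨ *-monoʳ-≤ 4 last-cost ⟩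
      4 * recol A e es    ∎)
    where
      open ≤-Reasoning
      p = pow2 (suc k)
      rearrange : ∀ p → 2 * (p + p) ≡ 4 * p
      rearrange = solve-∀

module LowerBounds (n : ℕ) (4≤n : 4 ≤ n) (A : Algorithm n) (correct : Correct A) where
  open Adversary A correct

  L : ℕ
  L = ⌊log₂ n ⌋

  2≤L : 2 ≤ L
  2≤L = ⌊log₂⌋-mono-≤ 4≤n

  pow2L≤n : pow2 L ≤ n
  pow2L≤n = subst (_≤ n) (sym (pow2≡2^ L))
    (k≤⌊log₂n⌋⇒2^k≤n L n {{>-nonZero (≤-trans (s≤s z≤n) 4≤n)}} ≤-refl)

  block : Fin (pow2 L) → Fin n
  block i = inject≤ i pow2L≤n

  run : Forced L block []
  run = force L block (inject≤-injective pow2L≤n pow2L≤n _ _) [] tt []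

  amortized-bound : ∃ λ (es : History n) → Valid es × 1 ≤ length es
                    × length es * ⌊log₂ n ⌋ ≤ 4 * totalRecol A es
  amortized-bound = Forced.history run , Forced.valid run , amortized L run 2≤L

  worst-case-bound : ∃ λ (e : Edge n) → ∃ λ (es : History n) → Valid (e ∷ es)
                     × n ≤ 4 * recol A e es
  worst-case-bound with worst-case L run 2≤L
  ... | e , es , valid , cost = e , es , valid , ≤-trans n≤2*pow2L cost
    where
      n≤2*pow2L : n ≤ 2 * pow2 L
      n≤2*pow2L = <⇒≤ (subst (λ p → n < 2 * p) (sym (pow2≡2^ L)) (n<2^suc⌊log₂n⌋ n))

lemma1 :
    -- amortized: Ω(log n) recolorings per update
    (∃ λ (c : ℕ) → ∃ λ (n₀ : ℕ) → ∀ (n : ℕ) → n₀ ≤ n →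
      (A : Algorithm n) → Correct A →
      ∃ λ (es : History n) → Valid es × 1 ≤ length es
        × length es * ⌊log₂ n ⌋ ≤ c * totalRecol A es)
    ×
    -- worst case: Ω(n) recolorings for a single update
    (∃ λ (c : ℕ) → ∃ λ (n₀ : ℕ) → ∀ (n : ℕ) → n₀ ≤ n →
      (A : Algorithm n) → Correct A →
      ∃ λ (e : Edge n) → ∃ λ (es : History n) → Valid (e ∷ es)
        × n ≤ c * recol A e es)
lemma1 = (4 , 4 , λ n 4≤n A correct → LowerBounds.amortized-bound n 4≤n A correct)
       , (4 , 4 , λ n 4≤n A correct → LowerBounds.worst-case-bound n 4≤n A correct)
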